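{- Let $T_1, T_2$ be primitive strings of length at least $2$ over a totally ordered alphabet, let $S = \mathrm{conj}_i(T_1)$ and $T = \mathrm{conj}_j(T_2)$ for some positions $i$ of $T_1$ and $j$ of $T_2$, let $U$ be the LMS-prefix of $\mathrm{conj}_i(T_1)$ and $V$ the LMS-prefix of $\mathrm{conj}_j(T_2)$. If $U <_{\mathit{LMS}} V$, then $S \prec_\omega T$.
   Context: For a string $T[1..n]$, $\mathrm{conj}_i(T) = T[i..n]T[1..i-1]$; strings are viewed cyclically (indices modulo $n$). $T$ is primitive if $T=S^k$ implies $k=1$; every string $T$ equals $\mathrm{root}(T)^{\exp(T)}$ for a unique primitive $\mathrm{root}(T)$ and integer $\exp(T)\ge 1$. $<_{\mathrm{lex}}$ is the lexicographic order (a proper prefix is smaller). The $\omega$-order: $X \prec_\omega Y$ if either $\mathrm{root}(X)=\mathrm{root}(Y)$ and $\exp(X)<\exp(Y)$, or $X^\omega <_{\mathrm{lex}} Y^\omega$, where $X^\omega$ is the infinite concatenation $XXX\cdots$. For a primitive string $T$ of length $n\ge 2$, position $i$ is S-type if $\mathrm{conj}_i(T) <_{\mathrm{lex}} \mathrm{conj}_{i+1}(T)$ and L-type if $\mathrm{conj}_i(T) >_{\mathrm{lex}} \mathrm{conj}_{i+1}(T)$; an S-type position $i$ is an LMS-position if $i-1$ (cyclically) is L-type. The LMS-prefix of $\mathrm{conj}_i(T)$ is the cyclic substring $T[i]T[i+1]\cdots T[j]$ (indices modulo $n$), where $j$ is the first LMS-position among $i+1, i+2, \ldots, i+n$ (taken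 cyclically). For two such LMS-prefixes $U, V$: $U <_{\mathit{LMS}} V$ if either $V$ is a proper prefix of $U$, or neither is a proper prefix of the other and $U <_{\mathrm{lex}} V$. -}

module Defs where

open import Level using (Level; _⊔_)
open import Data.Nat using (ℕ; zero; suc; _+_; _∸_; _<_; _≤_)
open import Data.Nat.DivMod using (_mod_)
open import Data.Fin using (Fin)
open import Data.List using (List; []; _∷_; _++_; length; take; drop; lookup)
open import Data.List.Relation.Binary.Lex.Strict using (Lex-<)
open import Data.Product using (Σ; ∃; _×_; _,_)
open import Data.Sum using (_⊎_)
open import Data.Empty using (⊥)
open import Data.Unit using (⊤)
open import Relation.Nullary using (¬_)
open import Relation.Binary.Core using (Rel)
open import Relation.Binary.PropositionalEquality using (_≡_)

-- Strings over an alphabet A with a (strict, total) order _≺_.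
-- Positions are 0-indexed: position i of the paper corresponds to i ∸ 1 here.
module Strings {a ℓ : Level} (A : Set a) (_≺_ : Rel A ℓ) where

  -- lexicographic order <_lex (a proper prefix is smaller)
  _<lex_ : List A → List A → Set (a ⊔ ℓ)
  _<lex_ = Lex-< _≡_ _≺_

  pow : List A → ℕ → List A
  pow S zero    = []
  pow S (suc k) = S ++ pow S k

  Primitive : List A → Set a
  Primitive T = ∀ (S : List A) (k : ℕ) → T ≡ pow S k → k ≡ 1

  RootExp : List A → List A → ℕ → Set a
  RootExp X R e = Primitive R × (1 ≤ e) × (X ≡ pow R e)

  -- m mod n, with m mod 0 = 0 (only used with n ≥ 1)
  _modℕ_ : ℕ → ℕ → ℕ
  m modℕ zero  = zero
  m modℕ suc n = Data.Fin.toℕ (m mod suc n)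

  conj : List A → ℕ → List A
  conj T i = drop (i modℕ length T) T ++ take (i modℕ length T) T

  -- the infinite string X^ω of a nonempty string x ∷ xs, as a function ℕ → A
  omegaAt : A → List A → ℕ → A
  omegaAt x xs k = lookup (x ∷ xs) (k mod suc (length xs))

  -- X^ω <_lex Y^ω  (the empty string's ω-power is empty)
  _<ωlex_ : List A → List A → Set (a ⊔ ℓ)
  []       <ωlex []       = Data.Empty.Polymorphic.⊥
    where import Data.Empty.Polymorphic
  []       <ωlex (_ ∷ _)  = Data.Unit.Polymorphic.⊤
    where import Data.Unit.Polymorphic
  (_ ∷ _)  <ωlex []       = Data.Empty.Polymorphic.⊥
    where import Data.Empty.Polymorphic
  (x ∷ xs) <ωlex (y ∷ ys) =
    ∃ λ k → (∀ m → m < k → omegaAt x xs m ≡ omegaAt y ys m)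
          × (omegaAt x xs k ≺ omegaAt y ys k)

  _≺ω_ : List A → List A → Set (a ⊔ ℓ)
  X ≺ω Y = (∃ λ R → ∃ λ e₁ → ∃ λ e₂ → RootExp X R e₁ × RootExp Y R e₂ × e₁ < e₂)
         ⊎ (X <ωlex Y)

  SType : List A → ℕ → Set (a ⊔ ℓ)
  SType T i = conj T i <lex conj T (suc i)

  LType : List A → ℕ → Set (a ⊔ ℓ)
  LType T i = conj T (suc i) <lex conj T i

  -- LMS-position: S-type and the cyclically preceding position is L-type
  LMS : List A → ℕ → Set (a ⊔ ℓ)
  LMS T i = SType T i × LType T (i + length T ∸ 1)

  LMSPrefix : List A → ℕ → List A → Set (a ⊔ ℓ)
  LMSPrefix T i U =
    ∃ λ d → (1 ≤ d) × (d ≤ length T) × LMS T (i + d)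
          × (∀ d′ → 1 ≤ d′ → d′ < d → ¬ LMS T (i + d′))
          × (U ≡ take (suc d) (conj T i ++ conj T i))

  ProperPrefix : List A → List A → Set a
  ProperPrefix V U = ∃ λ W → (W ≢ []) × (U ≡ V ++ W)
    where open import Relation.Binary.PropositionalEquality using (_≢_)

  _<LMS_ : List A → List A → Set (a ⊔ ℓ)
  U <LMS V = Lift ℓ (ProperPrefix V U)
           ⊎ ((¬ ProperPrefix U V) × (¬ ProperPrefix V U) × (U <lex V))
    where open import Level using (Lift)

-- Compare the two conjugates through their infinite periodic words. If U and V differ before
-- either ends, that first difference already orders the words. Otherwise V is a proper prefix
-- of U, so the words agree up to the last letter p of V, which sits at an LMS-position of T₂
-- but not of T₁. In T₂ the letter before p is L-type and p is S-type, which forces a strict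
-- descent into p. The same descent in T₁ makes the letter before p L-type, so p, not being
-- LMS, is L-type there. From p on, the word of T₁ falls at its first change while that of T₂
-- rises, so the former is smaller.
module Submission where

open import Defs
open import Level using (Level; lift)
open import Function using (_∘_)
open import Data.Nat using (ℕ; zero; suc; _+_; _*_; _∸_; _<_; _≤_; z≤n; s≤s; _%_; _/_; NonZero; _<?_)
open import Data.Nat.Properties
open import Data.Nat.DivMod
  using (_mod_; m%n<n; m≡m%n+[m/n]*n; [m+n]%n≡m%n; %-distribˡ-+; m%n%n≡m%n; m<n⇒m%n≡m)
open import Data.Fin using (toℕ)
open import Data.Fin.Properties using (toℕ-fromℕ<; toℕ-injective; toℕ<n)
open import Data.List using (List; []; _∷_; _++_; length; take; drop; lookup; applyUpTo)
open import Data.List.Properties using (length-applyUpTo; lookup-applyUpTo; length-++; ∷-injective)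
open import Data.List.Relation.Binary.Lex.Core using (base; halt; this; next)
open import Data.List.Relation.Binary.Lex.Strict using (<-compare)
open import Data.List.Relation.Binary.Pointwise using (Pointwise; _∷_)
open import Data.Product using (∃; _×_; _,_; proj₁; proj₂)
open import Data.Sum using (_⊎_; inj₁; inj₂)
open import Data.Empty using (⊥-elim)
open import Relation.Nullary using (¬_; yes; no)
open import Relation.Binary.Core using (Rel)
open import Relation.Binary.Definitions using (Tri; tri<; tri≈; tri>)
open import Relation.Binary.Structures using (IsStrictTotalOrder)
open import Relation.Binary.PropositionalEquality

module _ {a : Level} {A : Set a} where

  applyUpTo-cong : ∀ {f g : ℕ → A} → (∀ p → f p ≡ g p) → ∀ n → applyUpTo f n ≡ applyUpTo g n
  applyUpTo-cong f≗g zero    = refl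
  applyUpTo-cong f≗g (suc n) = cong₂ _∷_ (f≗g 0) (applyUpTo-cong (f≗g ∘ suc) n)

  applyUpTo-++ : ∀ (f : ℕ → A) m n →
                 applyUpTo f m ++ applyUpTo (λ p → f (m + p)) n ≡ applyUpTo f (m + n)
  applyUpTo-++ f zero    n = refl
  applyUpTo-++ f (suc m) n = cong (f 0 ∷_) (applyUpTo-++ (f ∘ suc) m n)

  take-applyUpTo : ∀ (f : ℕ → A) {m n} → m ≤ n → take m (applyUpTo f n) ≡ applyUpTo f m
  take-applyUpTo f z≤n       = refl
  take-applyUpTo f (s≤s m≤n) = cong (f 0 ∷_) (take-applyUpTo (f ∘ suc) m≤n)

  drop-applyUpTo : ∀ (f : ℕ → A) m n → drop m (applyUpTo f n) ≡ applyUpTo (λ p → f (m + p)) (n ∸ m)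
  drop-applyUpTo f zero    n       = refl
  drop-applyUpTo f (suc m) zero    = refl
  drop-applyUpTo f (suc m) (suc n) = drop-applyUpTo (f ∘ suc) m n

  ≡-applyUpTo-lookup : ∀ (xs : List A) (f : ℕ → A) →
                       (∀ i → lookup xs i ≡ f (toℕ i)) → xs ≡ applyUpTo f (length xs)
  ≡-applyUpTo-lookup []       f eq = refl
  ≡-applyUpTo-lookup (x ∷ xs) f eq =
    cong₂ _∷_ (eq Data.Fin.zero) (≡-applyUpTo-lookup xs (f ∘ suc) (eq ∘ Data.Fin.suc))

  Pointwise-applyUpTo : ∀ {f g : ℕ → A} {n} → Pointwise _≡_ (applyUpTo f n) (applyUpTo g n) →
                        ∀ q → q < n → f q ≡ g q
  Pointwise-applyUpTo {n = suc n} (f0≡g0 ∷ _)  zero    _         = f0≡g0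
  Pointwise-applyUpTo {n = suc n} (_ ∷ rest)   (suc q) (s≤s q<n) = Pointwise-applyUpTo rest q q<n

  ++-applyUpTo-agree : ∀ {f g : ℕ → A} {m k} (ws : List A) →
                       applyUpTo f k ≡ applyUpTo g m ++ ws → ∀ q → q < m → f q ≡ g q
  ++-applyUpTo-agree {m = suc m} {suc k} ws eq zero    _         = proj₁ (∷-injective eq)
  ++-applyUpTo-agree {m = suc m} {suc k} ws eq (suc q) (s≤s q<m) =
    ++-applyUpTo-agree ws (proj₂ (∷-injective eq)) q q<m

Periodic : ∀ {a} {A : Set a} → ℕ → (ℕ → A) → Set a
Periodic n f = ∀ m → f (m + n) ≡ f m

module _ {a : Level} {A : Set a} {n : ℕ} {f : ℕ → A} (f-periodic : Periodic n f) where

  periodic-+* : ∀ m k → f (m + k * n) ≡ f m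
  periodic-+* m zero    = cong f (+-identityʳ m)
  periodic-+* m (suc k) = begin
    f (m + (n + k * n)) ≡⟨ cong f (trans (cong (m +_) (+-comm n (k * n))) (sym (+-assoc m (k * n) n))) ⟩
    f (m + k * n + n)   ≡⟨ f-periodic (m + k * n) ⟩
    f (m + k * n)       ≡⟨ periodic-+* m k ⟩
    f m                 ∎
    where open ≡-Reasoning

  periodic-% : .{{_ : NonZero n}} → ∀ m → f (m % n) ≡ f m
  periodic-% m = trans (sym (periodic-+* (m % n) (m / n))) (cong f (sym (m≡m%n+[m/n]*n m n)))

module Ordered {a ℓ : Level} {A : Set a} {_≺_ : Rel A ℓ} (sto : IsStrictTotalOrder _≡_ _≺_) where
  open Strings A _≺_ public
  open IsStrictTotalOrder sto using (compare) renaming (trans to ≺-trans; irrefl to ≺-irrefl)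

  infix 4 _<∞_
  _<∞_ : Rel (ℕ → A) (a Level.⊔ ℓ)
  w <∞ v = ∃ λ p → (∀ q → q < p → w q ≡ v q) × w p ≺ v p

  <∞-cong : ∀ {w w′ v v′ : ℕ → A} → (∀ p → w p ≡ w′ p) → (∀ p → v p ≡ v′ p) → w <∞ v → w′ <∞ v′
  <∞-cong w≗w′ v≗v′ (p , agree , w≺v) =
    p , (λ q q<p → trans (sym (w≗w′ q)) (trans (agree q q<p) (v≗v′ q))) ,
    subst₂ _≺_ (w≗w′ p) (v≗v′ p) w≺v

  <∞-asym : ∀ {w v : ℕ → A} → w <∞ v → ¬ v <∞ w
  <∞-asym (p , agree , w≺v) (r , agree′ , v≺w) with <-cmp p r
  ... | tri< p<r _ _ = ≺-irrefl (sym (agree′ p p<r)) w≺v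
  ... | tri≈ _ refl _ = ≺-irrefl refl (≺-trans w≺v v≺w)
  ... | tri> _ _ r<p = ≺-irrefl (sym (agree r r<p)) v≺w

  <∞-shiftˡ : ∀ {w v : ℕ → A} d → (∀ q → q < d → w q ≡ v q) →
              (λ p → w (d + p)) <∞ (λ p → v (d + p)) → w <∞ v
  <∞-shiftˡ {w} {v} d agree-below (p , agree , w≺v) = d + p , agree-all , w≺v
    where
      agree-all : ∀ q → q < d + p → w q ≡ v q
      agree-all q q<d+p with q <? d
      ... | yes q<d = agree-below q q<d
      ... | no q≮d = subst (λ r → w r ≡ v r) (m+[n∸m]≡n (≮⇒≥ q≮d))
                       (agree (q ∸ d) (+-cancelˡ-< d (q ∸ d) p
                         (subst (_< d + p) (sym (m+[n∸m]≡n (≮⇒≥ q≮d))) q<d+p)))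

  constant-run : ∀ (w : ℕ → A) {p} → (∀ q → q < p → w (suc q) ≡ w q) → ∀ q → q ≤ p → w q ≡ w 0
  constant-run w steps zero    _   = refl
  constant-run w steps (suc q) q<p = trans (steps q q<p) (constant-run w steps q (<⇒≤ q<p))

  descent-before-ascent : ∀ (w : ℕ → A) → w ∘ suc <∞ w → w ∘ suc <∞ w ∘ suc ∘ suc → w 1 ≺ w 0
  descent-before-ascent w (zero , _ , w₁≺w₀) _ = w₁≺w₀
  descent-before-ascent w (suc p , agree , fall) rise = ⊥-elim (<∞-asym rise (p , agree′ , fall))
    where
      run : ∀ q → q ≤ suc p → w q ≡ w 0
      run = constant-run w agree
      agree′ : ∀ q → q < p → w (suc (suc q)) ≡ w (suc q)
      agree′ q q<p = trans (run (suc (suc q)) (s≤s q<p)) (sym (run (suc q) (s≤s (<⇒≤ q<p))))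

  falling<∞rising : ∀ (w v : ℕ → A) → w ∘ suc <∞ w → v <∞ v ∘ suc → w 0 ≡ v 0 → w <∞ v
  falling<∞rising w v (p , w-run , w-falls) (r , v-run , v-rises) w₀≡v₀ = compare-runs (<-cmp p r)
    where
      w-const : ∀ q → q ≤ p → w q ≡ w 0
      w-const = constant-run w w-run
      v-const : ∀ q → q ≤ r → v q ≡ v 0
      v-const = constant-run v (λ q q<r → sym (v-run q q<r))
      agree : ∀ m → m ≤ p → m ≤ r → ∀ q → q < suc m → w q ≡ v q
      agree m m≤p m≤r q (s≤s q≤m) =
        trans (w-const q (≤-trans q≤m m≤p)) (trans w₀≡v₀ (sym (v-const q (≤-trans q≤m m≤r))))
      compare-runs : Tri (p < r) (p ≡ r) (r < p) → w <∞ v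
      compare-runs (tri< p<r _ _) =
        suc p , agree p ≤-refl (<⇒≤ p<r) ,
        subst₂ _≺_ refl (trans (w-const p ≤-refl) (trans w₀≡v₀ (sym (v-const (suc p) p<r)))) w-falls
      compare-runs (tri≈ _ p≡r _) =
        suc p , agree p ≤-refl (≤-reflexive p≡r) ,
        ≺-trans w-falls (subst₂ _≺_ (sym (agree p ≤-refl (≤-reflexive p≡r) p ≤-refl)) refl
                          (subst (λ m → v m ≺ v (suc m)) (sym p≡r) v-rises))
      compare-runs (tri> _ _ r<p) =
        suc r , agree r (<⇒≤ r<p) ≤-refl ,
        subst₂ _≺_ (sym (trans (w-const (suc r) r<p) (trans w₀≡v₀ (sym (v-const r ≤-refl))))) refl v-rises

  ProperPrefix⇒length< : ∀ {xs ys : List A} → ProperPrefix xs ys → length xs < length ys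
  ProperPrefix⇒length< ([] , W≢[] , _) = ⊥-elim (W≢[] refl)
  ProperPrefix⇒length< {xs} (w ∷ ws , _ , refl) =
    subst (length xs <_) (sym (length-++ xs)) (m<m+n (length xs) (s≤s z≤n))

  ProperPrefix-applyUpTo : ∀ {f g : ℕ → A} {m k} → ProperPrefix (applyUpTo g m) (applyUpTo f k) →
                           m < k × (∀ q → q < m → f q ≡ g q)
  ProperPrefix-applyUpTo {f} {g} {m} {k} pp@(ws , _ , eq) =
    subst₂ _<_ (length-applyUpTo g m) (length-applyUpTo f k) (ProperPrefix⇒length< pp) ,
    ++-applyUpTo-agree ws eq

  applyUpTo-<lex : ∀ {f g : ℕ → A} {m k} → applyUpTo f m <lex applyUpTo g k →
                   ProperPrefix (applyUpTo f m) (applyUpTo g k) ⊎ f <∞ g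
  applyUpTo-<lex {m = zero}  {zero}  (base ())
  applyUpTo-<lex {g = g} {zero}  {suc k} halt = inj₁ (applyUpTo g (suc k) , (λ ()) , refl)
  applyUpTo-<lex {m = suc m} {suc k} (this f₀≺g₀) = inj₂ (0 , (λ _ ()) , f₀≺g₀)
  applyUpTo-<lex {m = suc m} {suc k} (next f₀≡g₀ rest) with applyUpTo-<lex rest
  ... | inj₁ (ws , ws≢[] , eq) = inj₁ (ws , ws≢[] , cong₂ _∷_ (sym f₀≡g₀) eq)
  ... | inj₂ tail< = inj₂ (<∞-shiftˡ 1 (λ { zero _ → f₀≡g₀ ; (suc _) (s≤s ()) }) tail<)

  applyUpTo-<lex-≡-length : ∀ {f g : ℕ → A} {n} → applyUpTo f n <lex applyUpTo g n → f <∞ g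
  applyUpTo-<lex-≡-length lt with applyUpTo-<lex lt
  ... | inj₁ pp = ⊥-elim (<-irrefl refl (proj₁ (ProperPrefix-applyUpTo pp)))
  ... | inj₂ f<g = f<g

  omegaAt-applyUpTo : ∀ {L} {f : ℕ → A} → Periodic (suc L) f →
                      ∀ m → omegaAt (f 0) (applyUpTo (f ∘ suc) L) m ≡ f m
  omegaAt-applyUpTo {L} {f} f-periodic m = begin
    lookup (applyUpTo f (suc L)) (m mod suc N) ≡⟨ lookup-applyUpTo f (suc L) (m mod suc N) ⟩
    f (toℕ (m mod suc N))                      ≡⟨ cong f (toℕ-fromℕ< (m%n<n m (suc N))) ⟩
    f (m % suc N)                              ≡⟨ cong (λ l → f (m % suc l)) (length-applyUpTo (f ∘ suc) L) ⟩
    f (m % suc L)                              ≡⟨ periodic-% f-periodic m ⟩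
    f m                                        ∎
    where
      open ≡-Reasoning
      N = length (applyUpTo (f ∘ suc) L)

  <∞⇒<ωlex : ∀ {L₁ L₂} {f g : ℕ → A} → Periodic (suc L₁) f → Periodic (suc L₂) g →
             f <∞ g → applyUpTo f (suc L₁) <ωlex applyUpTo g (suc L₂)
  <∞⇒<ωlex f-periodic g-periodic =
    <∞-cong (sym ∘ omegaAt-applyUpTo f-periodic) (sym ∘ omegaAt-applyUpTo g-periodic)

  module Cyclic (x : A) (xs : List A) where

    T : List A
    T = x ∷ xs

    n : ℕ
    n = suc (length xs)

    ω : ℕ → A
    ω = omegaAt x xs

    suffix : ℕ → ℕ → A
    suffix k p = ω (k + p)

    ω-cong-% : ∀ m m′ → m % n ≡ m′ % n → ω m ≡ ω m′
    ω-cong-% m m′ eq =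
      cong (lookup T) (toℕ-injective
        (trans (toℕ-fromℕ< (m%n<n m n)) (trans eq (sym (toℕ-fromℕ< (m%n<n m′ n))))))

    ω-periodic : Periodic n ω
    ω-periodic m = ω-cong-% (m + n) m ([m+n]%n≡m%n m n)

    suffix-periodic : ∀ k → Periodic n (suffix k)
    suffix-periodic k m = trans (cong ω (sym (+-assoc k m n))) (ω-periodic (k + m))

    suffix-suc : ∀ k p → suffix (suc k) p ≡ suffix k (suc p)
    suffix-suc k p = cong ω (sym (+-suc k p))

    suffix-suc-suc : ∀ k p → suffix (suc (suc k)) p ≡ suffix k (suc (suc p))
    suffix-suc-suc k p = trans (suffix-suc (suc k) p) (suffix-suc k (suc p))

    suffix-+ : ∀ k e p → suffix (k + e) p ≡ suffix k (e + p)
    suffix-+ k e p = cong ω (+-assoc k e p)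

    suffix-n+ : ∀ k p → suffix k (n + p) ≡ suffix k p
    suffix-n+ k p = trans (cong (suffix k) (+-comm n p)) (suffix-periodic k p)

    suffix-+n : ∀ k p → suffix (k + n) p ≡ suffix k p
    suffix-+n k p = trans (suffix-+ k n p) (suffix-n+ k p)

    suffix-mod : ∀ k p → suffix (toℕ (k mod n)) p ≡ suffix k p
    suffix-mod k p = ω-cong-% (toℕ (k mod n) + p) (k + p) (begin
      (toℕ (k mod n) + p) % n       ≡⟨ cong (λ r → (r + p) % n) (toℕ-fromℕ< (m%n<n k n)) ⟩
      (k % n + p) % n               ≡⟨ %-distribˡ-+ (k % n) p n ⟩
      (k % n % n + p % n) % n       ≡⟨ cong (λ r → (r + p % n) % n) (m%n%n≡m%n k n) ⟩
      (k % n + p % n) % n           ≡⟨ %-distribˡ-+ k p n ⟨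
      (k + p) % n                   ∎)
      where open ≡-Reasoning

    T≡applyUpTo : T ≡ applyUpTo ω n
    T≡applyUpTo = ≡-applyUpTo-lookup T ω λ i →
      cong (lookup T) (toℕ-injective (sym (trans (toℕ-fromℕ< (m%n<n (toℕ i) n)) (m<n⇒m%n≡m (toℕ<n i)))))

    conj-window : ∀ k → conj T k ≡ applyUpTo (suffix k) n
    conj-window k = begin
      drop r T ++ take r T
        ≡⟨ cong (λ l → drop r l ++ take r l) T≡applyUpTo ⟩
      drop r (applyUpTo ω n) ++ take r (applyUpTo ω n)
        ≡⟨ cong₂ _++_ (drop-applyUpTo ω r n) (take-applyUpTo ω r≤n) ⟩
      applyUpTo (suffix r) (n ∸ r) ++ applyUpTo ω r
        ≡⟨ cong (applyUpTo (suffix r) (n ∸ r) ++_) (applyUpTo-cong wrap r) ⟩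
      applyUpTo (suffix r) (n ∸ r) ++ applyUpTo (λ p → suffix r (n ∸ r + p)) r
        ≡⟨ applyUpTo-++ (suffix r) (n ∸ r) r ⟩
      applyUpTo (suffix r) (n ∸ r + r)
        ≡⟨ cong (applyUpTo (suffix r)) (m∸n+n≡m r≤n) ⟩
      applyUpTo (suffix r) n
        ≡⟨ applyUpTo-cong (suffix-mod k) n ⟩
      applyUpTo (suffix k) n
        ∎
      where
        open ≡-Reasoning
        r = toℕ (k mod n)
        r≤n : r ≤ n
        r≤n = <⇒≤ (toℕ<n (k mod n))
        wrap : ∀ p → ω p ≡ suffix r (n ∸ r + p)
        wrap p = sym (trans (cong ω (trans (sym (+-assoc r (n ∸ r) p)) (cong (_+ p) (m+[n∸m]≡n r≤n))))
                            (suffix-n+ 0 p))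

    LMSPrefix-window : ∀ i {d U} → d ≤ n → U ≡ take (suc d) (conj T i ++ conj T i) →
                       U ≡ applyUpTo (suffix i) (suc d)
    LMSPrefix-window i {d} {U} d≤n U≡ = begin
      U
        ≡⟨ U≡ ⟩
      take (suc d) (conj T i ++ conj T i)
        ≡⟨ cong (take (suc d)) (cong₂ _++_ (conj-window i) (conj-window i)) ⟩
      take (suc d) (applyUpTo (suffix i) n ++ applyUpTo (suffix i) n)
        ≡⟨ cong (λ l → take (suc d) (applyUpTo (suffix i) n ++ l)) (applyUpTo-cong (sym ∘ suffix-n+ i) n) ⟩
      take (suc d) (applyUpTo (suffix i) n ++ applyUpTo (λ p → suffix i (n + p)) n)
        ≡⟨ cong (take (suc d)) (applyUpTo-++ (suffix i) n n) ⟩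
      take (suc d) (applyUpTo (suffix i) (n + n))
        ≡⟨ take-applyUpTo (suffix i) (≤-trans (s≤s d≤n) (m<m+n n (s≤s z≤n))) ⟩
      applyUpTo (suffix i) (suc d)
        ∎
      where open ≡-Reasoning

    conj-<lex⇒<∞ : ∀ k k′ → conj T k <lex conj T k′ → suffix k <∞ suffix k′
    conj-<lex⇒<∞ k k′ lt = applyUpTo-<lex-≡-length (subst₂ _<lex_ (conj-window k) (conj-window k′) lt)

    LMS⇒valley : ∀ k → LMS T (suc k) →
                 (suffix k ∘ suc <∞ suffix k) × (suffix k ∘ suc <∞ suffix k ∘ suc ∘ suc)
    LMS⇒valley k (S-type , L-type) =
      <∞-cong (λ p → trans (suffix-suc (k + n) p) (suffix-+n k (suc p))) (suffix-+n k)
              (conj-<lex⇒<∞ (suc (k + n)) (k + n) L-type) ,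
      <∞-cong (suffix-suc k) (suffix-suc-suc k) (conj-<lex⇒<∞ (suc k) (suc (suc k)) S-type)

    ¬LMS⇒falling : ∀ k → ¬ LMS T (suc k) → suffix k 1 ≺ suffix k 0 →
                   suffix k ∘ suc ∘ suc <∞ suffix k ∘ suc
    ¬LMS⇒falling k ¬lms falls with <-compare sym compare (conj T (suc k)) (conj T (suc (suc k)))
    ... | tri< S-type _ _ = ⊥-elim (¬lms (S-type , L-type))
      where
        L-type : LType T (k + n)
        L-type = subst₂ _<lex_ (sym (conj-window (suc (k + n)))) (sym (conj-window (k + n)))
                   (this (subst₂ _≺_ (sym (trans (suffix-suc (k + n) 0) (suffix-+n k 1)))
                                 (sym (suffix-+n k 0)) falls))
    ... | tri≈ _ equal _ = ⊥-elim (≺-irrefl flat falls)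
      where
        agree : ∀ q → q < n → suffix (suc k) q ≡ suffix (suc (suc k)) q
        agree = Pointwise-applyUpTo
                  (subst₂ (Pointwise _≡_) (conj-window (suc k)) (conj-window (suc (suc k))) equal)
        steps : ∀ q → q < length xs → suffix (suc k) (suc q) ≡ suffix (suc k) q
        steps q q<l = trans (sym (suffix-suc (suc k) q)) (sym (agree q (m<n⇒m<1+n q<l)))
        run : suffix (suc k) (length xs) ≡ suffix (suc k) 0
        run = constant-run (suffix (suc k)) steps (length xs) ≤-refl
        flat : suffix k 1 ≡ suffix k 0
        flat = begin
          suffix k 1                  ≡⟨ suffix-suc k 0 ⟨
          suffix (suc k) 0            ≡⟨ run ⟨
          suffix (suc k) (length xs)  ≡⟨ suffix-suc k (length xs) ⟩
          suffix k n                  ≡⟨ suffix-periodic k 0 ⟩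
          suffix k 0                  ∎
          where open ≡-Reasoning
    ... | tri> _ _ rises =
      <∞-cong (suffix-suc-suc k) (suffix-suc k) (conj-<lex⇒<∞ (suc (suc k)) (suc k) rises)

  module Comparison (x₁ : A) (xs₁ : List A) (x₂ : A) (xs₂ : List A) where
    module C₁ = Cyclic x₁ xs₁
    module C₂ = Cyclic x₂ xs₂

    LMS-vs-non-LMS : ∀ k l → C₁.suffix k 0 ≡ C₂.suffix l 0 → C₁.suffix k 1 ≡ C₂.suffix l 1 →
                     LMS C₂.T (suc l) → ¬ LMS C₁.T (suc k) → C₁.suffix k ∘ suc <∞ C₂.suffix l ∘ suc
    LMS-vs-non-LMS k l σ₀≡τ₀ σ₁≡τ₁ lms ¬lms =
      falling<∞rising (σ ∘ suc) (τ ∘ suc) (C₁.¬LMS⇒falling k ¬lms σ₁≺σ₀) τ-rises σ₁≡τ₁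
      where
        σ = C₁.suffix k
        τ = C₂.suffix l
        τ-falls = proj₁ (C₂.LMS⇒valley l lms)
        τ-rises = proj₂ (C₂.LMS⇒valley l lms)
        σ₁≺σ₀ : σ 1 ≺ σ 0
        σ₁≺σ₀ = subst₂ _≺_ (sym σ₁≡τ₁) (sym σ₀≡τ₀) (descent-before-ascent τ τ-falls τ-rises)

    <LMS⇒<∞ : ∀ {i j U V} → LMSPrefix C₁.T i U → LMSPrefix C₂.T j V → U <LMS V →
              C₁.suffix i <∞ C₂.suffix j
    <LMS⇒<∞ {i} {j} {U} {V} (d₁ , _ , d₁≤n₁ , _ , ¬lms₁ , U≡) (suc e , _ , d₂≤n₂ , lms₂ , _ , V≡) =
      compare-windows
      where
        U-window : U ≡ applyUpTo (C₁.suffix i) (suc d₁)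
        U-window = C₁.LMSPrefix-window i d₁≤n₁ U≡
        V-window : V ≡ applyUpTo (C₂.suffix j) (suc (suc e))
        V-window = C₂.LMSPrefix-window j d₂≤n₂ V≡
        compare-windows : U <LMS V → C₁.suffix i <∞ C₂.suffix j
        compare-windows (inj₂ (U⋢V , _ , U<V)) with applyUpTo-<lex (subst₂ _<lex_ U-window V-window U<V)
        ... | inj₁ U⊏V = ⊥-elim (U⋢V (subst₂ ProperPrefix (sym U-window) (sym V-window) U⊏V))
        ... | inj₂ s<t = s<t
        compare-windows (inj₁ (lift V⊏U)) =
          <∞-shiftˡ (suc e) (λ q q<d₂ → agree q (m<n⇒m<1+n q<d₂))
            (<∞-cong (λ p → trans (C₁.suffix-+ i e (suc p)) (cong (C₁.suffix i) (+-suc e p)))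
                     (λ p → trans (C₂.suffix-+ j e (suc p)) (cong (C₂.suffix j) (+-suc e p)))
                     (LMS-vs-non-LMS (i + e) (j + e) (agree-near 0 z≤n) (agree-near 1 ≤-refl)
                        (subst (LMS C₂.T) (+-suc j e) lms₂)
                        (¬lms₁ (suc e) (s≤s z≤n) (≤-pred d₂<d₁) ∘ subst (LMS C₁.T) (sym (+-suc i e)))))
          where
            windows = ProperPrefix-applyUpTo (subst₂ ProperPrefix V-window U-window V⊏U)
            d₂<d₁ : suc (suc e) < suc d₁
            d₂<d₁ = proj₁ windows
            agree : ∀ q → q < suc (suc e) → C₁.suffix i q ≡ C₂.suffix j q
            agree = proj₂ windows
            agree-near : ∀ p → p ≤ 1 → C₁.suffix (i + e) p ≡ C₂.suffix (j + e) p
            agree-near p p≤1 =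
              trans (C₁.suffix-+ i e p) (trans (agree (e + p) e+p<2+e) (sym (C₂.suffix-+ j e p)))
              where
                e+p<2+e : e + p < suc (suc e)
                e+p<2+e = s≤s (subst (e + p ≤_) (+-comm e 1) (+-monoʳ-≤ e p≤1))

lemma5 : ∀ {a ℓ : Level} {A : Set a} {_≺_ : Rel A ℓ} → IsStrictTotalOrder _≡_ _≺_ →
         let open Strings A _≺_ in
         (T₁ T₂ : List A) → Primitive T₁ → Primitive T₂ →
         2 ≤ length T₁ → 2 ≤ length T₂ →
         (i j : ℕ) → i < length T₁ → j < length T₂ →
         (U V : List A) → LMSPrefix T₁ i U → LMSPrefix T₂ j V →
         U <LMS V → conj T₁ i ≺ω conj T₂ j
lemma5 sto (x₁ ∷ xs₁) (x₂ ∷ xs₂) _ _ _ _ i j _ _ U V U-prefix V-prefix U<V =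
  inj₂ (subst₂ _<ωlex_ (sym (C₁.conj-window i)) (sym (C₂.conj-window j))
         (<∞⇒<ωlex (C₁.suffix-periodic i) (C₂.suffix-periodic j) (<LMS⇒<∞ U-prefix V-prefix U<V)))
  where
    open Ordered sto
    open Comparison x₁ xs₁ x₂ xs₂
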